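{- Let $p\equiv 1\pmod 4$ be a prime and let $u$ be an integer with $u^2\equiv -1\pmod p$ and $1\le u<p/2$. Define points $\mathbf{x}_i=(x_i,y_i)\in\mathbb{Z}^2$ by the extended Brillhart (Euclidean) recursion: $\mathbf{x}_0=(p,0)$, $\mathbf{x}_1=(u,1)$, and, for $i\ge 1$ with $x_i>0$, write $x_{i-1}=q_ix_i+r_i$ with integers $q_i$ and $0\le r_i<x_i$ (so $q_i=\lfloor x_{i-1}/x_i\rfloor$), and set $\mathbf{x}_{i+1}=\mathbf{x}_{i-1}-q_i\mathbf{x}_i=(r_i,\,y_{i-1}-q_iy_i)$. Define also the modified Lagrange sequence $\mathbf{x}'_i$ by $\mathbf{x}'_0=(p,0)$, $\mathbf{x}'_1=(u,1)$, and, for $i\ge 1$, as long as $\|\mathbf{x}'_i\|\le\|\mathbf{x}'_{i-1}\|$, $$q'_i=\left\lfloor\frac{\mathbf{x}'_i\cdot\mathbf{x}'_{i-1}}{\|\mathbf{x}'_i\|^2}\right\rfloor,\qquad \mathbf{x}'_{i+1}=\mathbf{x}'_{i-1}-q'_i\mathbf{x}'_i,$$ where $\cdot$ is the standard dot product and $\|\cdot\|$ the Euclidean norm. Then for every $i\ge 1$ such that $x_i>|y_i|$, we have $$\left\lfloor\frac{x_{i-1}}{x_i}\right\rfloor=\left\lfloor\frac{x_{i-1}x_i+y_{i-1}y_i}{x_i^2+y_i^2}\right\rfloor,$$ i.e. $q_i=q'_i$; consequently the two sequences coincide ($\mathbf{x}'_j=\mathbf{x}_j$) for all indices up to the point where $x_i\le|y_i|$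 (until the modified Lagrange algorithm terminates).
   Context: $\lfloor\cdot\rfloor$ denotes the floor function. The sequence $(x_i)$ is the sequence of remainders of the ordinary Euclidean algorithm (with nonnegative remainders) applied to $p$ and $u$; Brillhart's algorithm for writing $p$ as a sum of two squares stops at the first remainder less than $\sqrt p$. The modified Lagrange algorithm is Lagrange's lattice-reduction algorithm in which the integer multiple subtracted is chosen by rounding down (so that generated vectors keep positive $x$-component), applied to the lattice $L=\{(x,y)\in\mathbb{Z}^2: x\equiv uy\pmod p\}$ starting from $(p,0)$ and $(u,1)$. -}

module Defs where

open import Data.Nat using (ℕ; zero; suc)
import Data.Nat as ℕ
open import Data.Integer using (ℤ; +_; +[1+_]; -[1+_]; _+_; _-_; _*_; _/_; _≤?_)
open import Data.Product using (_×_; _,_; proj₂)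
open import Data.Maybe using (Maybe; just; nothing; _>>=_)
import Data.Maybe as Maybe
open import Relation.Nullary.Decidable using (does)
open import Data.Bool using (if_then_else_)

Vec2 : Set
Vec2 = ℤ × ℤ

xc : Vec2 → ℤ
xc (a , _) = a

yc : Vec2 → ℤ
yc (_ , b) = b

_·_ : Vec2 → Vec2 → ℤ
(a , b) · (c , d) = a * c + b * d

‖_‖² : Vec2 → ℤ
‖ v ‖² = v · v

_-[_]_ : Vec2 → ℤ → Vec2 → Vec2
(a , b) -[ q ] (c , d) = (a - q * c , b - q * d)

-- For b ≠ 0 this is the library's integer
-- division _/_ (which rounds down when the divisor is positive — the only
-- case in which it is used here); the value for b = 0 is an irrelevant
-- junk value.
⌊_/_⌋ : ℤ → ℤ → ℤ
⌊ a / + zero ⌋ = + 0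
⌊ a / +[1+ n ] ⌋ = a / +[1+ n ]
⌊ a / -[1+ n ] ⌋ = a / -[1+ n ]

0<? : ℤ → Data.Bool.Bool
0<? (+ suc _) = Data.Bool.true
0<? _ = Data.Bool.false

-- Extended Brillhart (Euclidean) recursion.
-- brillhartPair i = just (x_i , x_{i+1}) when the recursion has produced
-- x_{i+1}, i.e. when x_1, …, x_i all have positive x-component;
-- otherwise nothing (undefined).

brillhartPair : ℕ → ℕ → ℕ → Maybe (Vec2 × Vec2)
brillhartPair p u zero = just ((+ p , + 0) , (+ u , + 1))
brillhartPair p u (suc i) = brillhartPair p u i >>= step
  where
  step : Vec2 × Vec2 → Maybe (Vec2 × Vec2)
  step (v , w) =
    if 0<? (xc w) then just (w , v -[ ⌊ xc v / xc w ⌋ ] w) else nothing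

brillhart : ℕ → ℕ → ℕ → Maybe Vec2
brillhart p u zero = just (+ p , + 0)
brillhart p u (suc i) = Maybe.map proj₂ (brillhartPair p u i)

-- Modified Lagrange algorithm on L, from (p,0) and (u,1).
-- lagrangePair i = just (x'_i , x'_{i+1}) when the steps at indices
-- 1, …, i were all performed, i.e. ‖x'_k‖ ≤ ‖x'_{k-1}‖ for k = 1, …, i.

lagrangePair : ℕ → ℕ → ℕ → Maybe (Vec2 × Vec2)
lagrangePair p u zero = just ((+ p , + 0) , (+ u , + 1))
lagrangePair p u (suc i) = lagrangePair p u i >>= step
  where
  step : Vec2 × Vec2 → Maybe (Vec2 × Vec2)
  step (v , w) =
    if does (‖ w ‖² ≤? ‖ v ‖²)
    then just (w , v -[ ⌊ (w · v) / ‖ w ‖² ⌋ ] w)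
    else nothing

lagrange : ℕ → ℕ → ℕ → Maybe Vec2
lagrange p u zero = just (+ p , + 0)
lagrange p u (suc i) = Maybe.map proj₂ (lagrangePair p u i)

{-# OPTIONS --safe #-}
module Submission where

-- Consecutive Brillhart points v = x_{i-1}, w = x_i = (c, d) lie in the lattice L, on
-- which dot products are multiples of p because u² ≡ -1 (mod p); they form a basis of L
-- (det = ±p), have nonnegative x-coordinates and y-coordinates of opposite signs. With
-- q = ⌊x_{i-1} / c⌋ and x = v - q w = (r, e) we have v·w = q‖w‖² + w·x, so q is also the
-- Lagrange quotient as soon as 0 ≤ w·x < ‖w‖². The upper bound follows from the sign
-- pattern and 0 ≤ r < c. For the lower bound, (w·x + p) c = r‖w‖² + p (c ± d) > 0 when
-- c > |d|, and w·x is a multiple of p. Dividing Lagrange's identity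
-- ‖w‖²‖x‖² = (w·x)² + p² by p² gives αβ = γ² + 1 with 0 ≤ γ < α, hence β ≤ α: the
-- Brillhart step also shortens the vector, so the Lagrange algorithm takes the same step.

open import Defs
open import Data.Nat.Base using (ℕ)
open import Data.Integer.Base using (ℤ; +_; 1ℤ) renaming (_<_ to _<ℤ_; _+_ to _+ℤ_; _*_ to _*ℤ_)
open import Data.Integer.Divisibility.Signed using () renaming (_∣_ to _∣ℤ_)

module IntegerLemmas where
  open import Data.Nat.Base as ℕ using (ℕ; z≤n; s≤s)
  open import Data.Integer
  open import Data.Integer.Properties
  open import Data.Integer.Tactic.RingSolver using (solve-∀)
  open import Relation.Binary.PropositionalEquality
  open import Data.Sum using (_⊎_; inj₁; inj₂)
  open import Data.Integer.Divisibility.Signed using (_∣_; divides; ∣ᵤ⇒∣)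
  open import Data.Nat.Divisibility using () renaming (_∣_ to _∣ℕ_)

  0≤i*i : ∀ i → 0ℤ ≤ i * i
  0≤i*i (+ n) rewrite sym (pos-* n n) = +≤+ z≤n
  0≤i*i -[1+ n ] = +≤+ z≤n

  0≤i⇒0≤j⇒0≤i*j : ∀ {i j} → 0ℤ ≤ i → 0ℤ ≤ j → 0ℤ ≤ i * j
  0≤i⇒0≤j⇒0≤i*j {+ m} {+ n} _ _ rewrite sym (pos-* m n) = +≤+ z≤n

  0<i⇒0<j⇒0<i*j : ∀ {i j} → 0ℤ < i → 0ℤ < j → 0ℤ < i * j
  0<i⇒0<j⇒0<i*j {+[1+ m ]} {+[1+ n ]} _ _ = +<+ (s≤s z≤n)
  0<i⇒0<j⇒0<i*j {+ 0} (+<+ ()) _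
  0<i⇒0<j⇒0<i*j {+[1+ m ]} {+ 0} _ (+<+ ())

  i<j⇒0<j-i : ∀ {i j} → i < j → 0ℤ < j - i
  i<j⇒0<j-i {i} {j} i<j = subst (_< j - i) (+-inverseʳ i) (+-monoˡ-< (- i) i<j)

  0<j-i⇒i<j : ∀ {i j} → 0ℤ < j - i → i < j
  0<j-i⇒i<j {i} {j} 0<j-i = subst₂ _<_ (+-identityʳ i) (cancel i j) (+-monoʳ-< i 0<j-i)
    where
    cancel : ∀ i j → i + (j - i) ≡ j
    cancel = solve-∀

  i*n<j*n+n⇒i≤j : ∀ {i j n} → 0ℤ < n → i * n < j * n + n → i ≤ j
  i*n<j*n+n⇒i≤j {i} {j} {n} 0<n i*n<j*n+n =
    subst (i ≤_) (trans (sym (+-pred j 1ℤ)) (+-identityʳ j)) (i<j⇒i≤pred[j] i<j+1)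
    where
    factor : ∀ j n → j * n + n ≡ (j + 1ℤ) * n
    factor = solve-∀
    i<j+1 : i < j + 1ℤ
    i<j+1 = *-cancelʳ-<-nonNeg n {{nonNegative (<⇒≤ 0<n)}} (subst (i * n <_) (factor j n) i*n<j*n+n)

  0≤i⇒i<j⇒i*i+1≤j*j : ∀ {i j} → 0ℤ ≤ i → i < j → i * i + 1ℤ ≤ j * j
  0≤i⇒i<j⇒i*i+1≤j*j {i} {j} 0≤i i<j = subst (_≤ j * j) (+-comm 1ℤ (i * i)) (i<j⇒suc[i]≤j i*i<j*j)
    where
    i*i<j*j : i * i < j * j
    i*i<j*j = ≤-<-trans (*-monoˡ-≤-nonNeg i {{nonNegative 0≤i}} (<⇒≤ i<j))
                        (*-monoʳ-<-pos j {{positive (≤-<-trans 0≤i i<j)}} i<j)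

  i*j≡k*k+1⇒j≤i : ∀ {i j k} → 0ℤ ≤ k → k < i → i * j ≡ k * k + 1ℤ → j ≤ i
  i*j≡k*k+1⇒j≤i {i} {j} 0≤k k<i eq =
    *-cancelˡ-≤-pos j i i {{positive (≤-<-trans 0≤k k<i)}}
      (subst (_≤ i * i) (sym eq) (0≤i⇒i<j⇒i*i+1≤j*j 0≤k k<i))

  ∣i∣<j⇒i<j : ∀ {i j} → + ∣ i ∣ < j → i < j
  ∣i∣<j⇒i<j {+ n} lt = lt
  ∣i∣<j⇒i<j { -[1+ n ]} lt = <-trans -<+ lt

  ∣i∣<j⇒-i<j : ∀ {i j} → + ∣ i ∣ < j → - i < j
  ∣i∣<j⇒-i<j {+ n} lt = ≤-<-trans neg-≤-pos lt
  ∣i∣<j⇒-i<j { -[1+ n ]} lt = lt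

  ≡±⇒-≡± : ∀ {i n} → i ≡ n ⊎ i ≡ - n → - i ≡ n ⊎ - i ≡ - n
  ≡±⇒-≡± (inj₁ refl) = inj₂ refl
  ≡±⇒-≡± {n = n} (inj₂ refl) = inj₁ (neg-involutive n)

  ≡±⇒*≡ : ∀ {i n} → i ≡ n ⊎ i ≡ - n → i * i ≡ n * n
  ≡±⇒*≡ (inj₁ refl) = refl
  ≡±⇒*≡ {n = n} (inj₂ refl) = square-neg n
    where
    square-neg : ∀ n → - n * - n ≡ n * n
    square-neg = solve-∀

  n∣i⇒0<i+n⇒0≤i : ∀ {i n} → 0ℤ < n → n ∣ i → 0ℤ < i + n → 0ℤ ≤ i
  n∣i⇒0<i+n⇒0≤i 0<n (divides γ refl) 0<i+n =
    0≤i⇒0≤j⇒0≤i*j (i*n<j*n+n⇒i≤j {0ℤ} {γ} 0<n 0<i+n) (<⇒≤ 0<n)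

  M*N≡X*X+P*P⇒N≤M : ∀ {M N X P} → 0ℤ < P → P ∣ M → P ∣ N → P ∣ X →
                    0ℤ ≤ X → X < M → M * N ≡ X * X + P * P → N ≤ M
  M*N≡X*X+P*P⇒N≤M {P = P} 0<P (divides α refl) (divides β refl) (divides γ refl) 0≤X X<M eq =
    *-monoʳ-≤-nonNeg P {{nonNegative (<⇒≤ 0<P)}} (i*j≡k*k+1⇒j≤i 0≤γ γ<α αβ≡γγ+1)
    where
    0≤γ : 0ℤ ≤ γ
    0≤γ = *-cancelʳ-≤-pos 0ℤ γ P {{positive 0<P}} 0≤X
    γ<α : γ < α
    γ<α = *-cancelʳ-<-nonNeg P {{nonNegative (<⇒≤ 0<P)}} X<M
    αβ≡γγ+1 : α * β ≡ γ * γ + 1ℤ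
    αβ≡γγ+1 = *-cancelʳ-≡ (α * β) (γ * γ + 1ℤ) (P * P) {{>-nonZero (0<i⇒0<j⇒0<i*j 0<P 0<P)}}
      (begin
        α * β * (P * P)         ≡⟨ regroup α β P ⟩
        α * P * (β * P)         ≡⟨ eq ⟩
        γ * P * (γ * P) + P * P ≡⟨ factor γ P ⟩
        (γ * γ + 1ℤ) * (P * P)  ∎)
      where
      open ≡-Reasoning
      regroup : ∀ α β P → α * β * (P * P) ≡ α * P * (β * P)
      regroup = solve-∀
      factor : ∀ γ P → γ * P * (γ * P) + P * P ≡ (γ * γ + 1ℤ) * (P * P)
      factor = solve-∀

  ∣n*n+1⇒+∣+n*+n+1 : ∀ {m n} → m ∣ℕ n ℕ.* n ℕ.+ 1 → + m ∣ + n * + n + 1ℤ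
  ∣n*n+1⇒+∣+n*+n+1 {m} {n} m∣n*n+1 =
    subst (+ m ∣_) (trans (pos-+ (n ℕ.* n) 1) (cong (_+ 1ℤ) (pos-* n n))) (∣ᵤ⇒∣ m∣n*n+1)

module FloorDivision where
  open import Data.Nat.Base as ℕ using (z≤n)
  open import Data.Integer
  open import Data.Integer.Properties
  open import Data.Integer.DivMod using ([n/d]*d≤n; n<s[n/ℕd]*d; div-pos-is-/ℕ; 0≤n⇒0≤n/d)
  open import Data.Integer.Tactic.RingSolver using (solve-∀)
  open import Relation.Binary.PropositionalEquality
  open IntegerLemmas using (i<j⇒0<j-i; 0<j-i⇒i<j; i*n<j*n+n⇒i≤j)

  ⌊x/n⌋*n≤x : ∀ {x n} → 0ℤ < n → ⌊ x / n ⌋ * n ≤ x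
  ⌊x/n⌋*n≤x {x} {+[1+ n ]} _ = [n/d]*d≤n x +[1+ n ]
  ⌊x/n⌋*n≤x {n = + 0} (+<+ ())

  x<⌊x/n⌋*n+n : ∀ {x n} → 0ℤ < n → x < ⌊ x / n ⌋ * n + n
  x<⌊x/n⌋*n+n {x} {+[1+ n ]} _ = begin-strict
    x                                   <⟨ n<s[n/ℕd]*d x (ℕ.suc n) ⟩
    suc (x /ℕ ℕ.suc n) * +[1+ n ]       ≡⟨ suc-* (x /ℕ ℕ.suc n) +[1+ n ] ⟩
    +[1+ n ] + x /ℕ ℕ.suc n * +[1+ n ]  ≡⟨ +-comm +[1+ n ] (x /ℕ ℕ.suc n * +[1+ n ]) ⟩
    x /ℕ ℕ.suc n * +[1+ n ] + +[1+ n ]  ≡⟨ cong (λ q → q * +[1+ n ] + +[1+ n ]) (div-pos-is-/ℕ x (ℕ.suc n)) ⟨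
    x / +[1+ n ] * +[1+ n ] + +[1+ n ]  ∎
    where open ≤-Reasoning
  x<⌊x/n⌋*n+n {n = + 0} (+<+ ())

  0≤⌊x/n⌋ : ∀ {x n} → 0ℤ ≤ x → 0ℤ < n → 0ℤ ≤ ⌊ x / n ⌋
  0≤⌊x/n⌋ {x} {+[1+ n ]} 0≤x _ = 0≤n⇒0≤n/d x +[1+ n ] 0≤x (+≤+ z≤n)
  0≤⌊x/n⌋ {n = + 0} _ (+<+ ())

  x-⌊x/n⌋*n<n : ∀ {x n} → 0ℤ < n → x - ⌊ x / n ⌋ * n < n
  x-⌊x/n⌋*n<n {x} {n} 0<n =
    0<j-i⇒i<j (subst (0ℤ <_) (identity x n ⌊ x / n ⌋) (i<j⇒0<j-i (x<⌊x/n⌋*n+n {x} 0<n)))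
    where
    identity : ∀ x n q → q * n + n - x ≡ n - (x - q * n)
    identity = solve-∀

  ⌊x/n⌋-unique : ∀ {x n q} → 0ℤ < n → q * n ≤ x → x < q * n + n → ⌊ x / n ⌋ ≡ q
  ⌊x/n⌋-unique 0<n qn≤x x<qn+n = ≤-antisym
    (i*n<j*n+n⇒i≤j 0<n (≤-<-trans (⌊x/n⌋*n≤x 0<n) x<qn+n))
    (i*n<j*n+n⇒i≤j 0<n (≤-<-trans qn≤x (x<⌊x/n⌋*n+n 0<n)))

module PlaneVectors where
  open import Data.Integer
  open import Data.Integer.Properties using (+-mono-<-≤)
  open IntegerLemmas using (0<i⇒0<j⇒0<i*j; 0≤i*i)
  open import Data.Integer.Tactic.RingSolver using (solve-∀)
  open import Data.Product using (_,_)
  open import Relation.Binary.PropositionalEquality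

  0<xv⇒0<‖v‖² : ∀ {v} → 0ℤ < xc v → 0ℤ < ‖ v ‖²
  0<xv⇒0<‖v‖² {c , d} 0<c = +-mono-<-≤ (0<i⇒0<j⇒0<i*j 0<c 0<c) (0≤i*i d)

  det : Vec2 → Vec2 → ℤ
  det (a , b) (c , d) = a * d - b * c

  ·-comm : ∀ v w → v · w ≡ w · v
  ·-comm (a , b) (c , d) = identity a b c d
    where
    identity : ∀ a b c d → a * c + b * d ≡ c * a + d * b
    identity = solve-∀

  v·w≡q*‖w‖²+w·[v-qw] : ∀ v w q → v · w ≡ q * ‖ w ‖² + w · (v -[ q ] w)
  v·w≡q*‖w‖²+w·[v-qw] (a , b) (c , d) q = identity a b c d q
    where
    identity : ∀ a b c d q → a * c + b * d ≡ q * (c * c + d * d) + (c * (a - q * c) + d * (b - q * d))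
    identity = solve-∀

  det-[v-qw] : ∀ v w q → det w (v -[ q ] w) ≡ - det v w
  det-[v-qw] (a , b) (c , d) q = identity a b c d q
    where
    identity : ∀ a b c d q → c * (b - q * d) - d * (a - q * c) ≡ - (a * d - b * c)
    identity = solve-∀

  lagrange-identity : ∀ v w → ‖ v ‖² * ‖ w ‖² ≡ v · w * (v · w) + det v w * det v w
  lagrange-identity (a , b) (c , d) = identity a b c d
    where
    identity : ∀ a b c d → (a * a + b * b) * (c * c + d * d)
                           ≡ (a * c + b * d) * (a * c + b * d) + (a * d - b * c) * (a * d - b * c)
    identity = solve-∀

module Lattice (P U : ℤ) (P∣U*U+1 : P ∣ℤ U *ℤ U +ℤ 1ℤ) where
  open import Data.Integer
  open import Data.Integer.Properties
  open import Data.Integer.Divisibility.Signed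
  open import Data.Integer.Tactic.RingSolver using (solve-∀)
  open import Data.Product using (_,_)
  open import Data.Sum using (_⊎_; inj₁; inj₂)
  open import Relation.Binary.PropositionalEquality
  open import Data.Nat.Base using (z≤n)
  open IntegerLemmas
  open FloorDivision
  open PlaneVectors

  _∈L : Vec2 → Set
  (x , y) ∈L = P ∣ x - U * y

  [v-qw]∈L : ∀ v w q → v ∈L → w ∈L → (v -[ q ] w) ∈L
  [v-qw]∈L (a , b) (c , d) q v∈L w∈L =
    subst (P ∣_) (identity U a b c d q) (∣m∣n⇒∣m-n v∈L (∣n⇒∣m*n q w∈L))
    where
    identity : ∀ U a b c d q → a - U * b - q * (c - U * d) ≡ a - q * c - U * (b - q * d)
    identity = solve-∀

  ∈L⇒∣· : ∀ v w → v ∈L → w ∈L → P ∣ v · w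
  ∈L⇒∣· (a , b) (c , d) v∈L w∈L =
    subst (P ∣_) (identity U a b c d)
      (∣m∣n⇒∣m+n (∣m∣n⇒∣m+n (∣m⇒∣m*n c v∈L) (∣n⇒∣m*n (U * b) w∈L))
                 (∣m⇒∣m*n (b * d) P∣U*U+1))
    where
    identity : ∀ U a b c d → (a - U * b) * c + U * b * (c - U * d) + (U * U + 1ℤ) * (b * d) ≡ a * c + b * d
    identity = solve-∀

  record Consecutive (v w : Vec2) : Set where
    field
      0≤x₁ : 0ℤ ≤ xc v
      0≤x₂ : 0ℤ ≤ xc w
      y₁*y₂≤0 : yc v * yc w ≤ 0ℤ
      det≡±P : det v w ≡ P ⊎ det v w ≡ - P
      ∈L₁ : v ∈L
      ∈L₂ : w ∈L

  consecutive-step : ∀ {v w} q → Consecutive v w → 0ℤ ≤ q → 0ℤ ≤ xc v - q * xc w →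
                     Consecutive w (v -[ q ] w)
  consecutive-step {a , b} {c , d} q vw 0≤q 0≤r = record
    { 0≤x₁ = 0≤x₂
    ; 0≤x₂ = 0≤r
    ; y₁*y₂≤0 = subst (_≤ 0ℤ) (sym (identity b d q))
                  (+-mono-≤ y₁*y₂≤0 (neg-mono-≤ (0≤i⇒0≤j⇒0≤i*j 0≤q (0≤i*i d))))
    ; det≡±P = subst (λ D → D ≡ P ⊎ D ≡ - P) (sym (det-[v-qw] (a , b) (c , d) q)) (≡±⇒-≡± det≡±P)
    ; ∈L₁ = ∈L₂
    ; ∈L₂ = [v-qw]∈L (a , b) (c , d) q ∈L₁ ∈L₂
    }
    where
    open Consecutive vw
    identity : ∀ b d q → d * (b - q * d) ≡ b * d + - (q * (d * d))
    identity = solve-∀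

  consecutive-euclid-step : ∀ {v w} → Consecutive v w → 0ℤ < xc w →
                            Consecutive w (v -[ ⌊ xc v / xc w ⌋ ] w)
  consecutive-euclid-step {v} vw 0<xw =
    consecutive-step _ vw (0≤⌊x/n⌋ (Consecutive.0≤x₁ vw) 0<xw) (i≤j⇒0≤j-i (⌊x/n⌋*n≤x {xc v} 0<xw))

  consecutive-·<‖‖² : ∀ {w x} → Consecutive w x → xc x < xc w → w · x < ‖ w ‖²
  consecutive-·<‖‖² {c , d} {r , e} wx r<c = 0<j-i⇒i<j (subst (0ℤ <_) (sym (identity c d r e))
    (+-mono-<-≤ (+-mono-<-≤ (0<i⇒0<j⇒0<i*j 0<c (i<j⇒0<j-i r<c)) (0≤i*i d)) (neg-mono-≤ y₁*y₂≤0)))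
    where
    open Consecutive wx
    0<c : 0ℤ < c
    0<c = ≤-<-trans 0≤x₂ r<c
    identity : ∀ c d r e → c * c + d * d - (c * r + d * e) ≡ c * (c - r) + d * d + - (d * e)
    identity = solve-∀

  module _ (0<P : 0ℤ < P) where

    0<P*c+d*D : ∀ {c d D} → + ∣ d ∣ < c → D ≡ P ⊎ D ≡ - P → 0ℤ < P * c + d * D
    0<P*c+d*D {c} {d} ∣d∣<c (inj₁ refl) = subst (0ℤ <_) (sym (identity P c d))
      (0<i⇒0<j⇒0<i*j 0<P (i<j⇒0<j-i (∣i∣<j⇒-i<j ∣d∣<c)))
      where
      identity : ∀ P c d → P * c + d * P ≡ P * (c - - d)
      identity = solve-∀
    0<P*c+d*D {c} {d} ∣d∣<c (inj₂ refl) = subst (0ℤ <_) (sym (identity P c d))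
      (0<i⇒0<j⇒0<i*j 0<P (i<j⇒0<j-i (∣i∣<j⇒i<j ∣d∣<c)))
      where
      identity : ∀ P c d → P * c + d * - P ≡ P * (c - d)
      identity = solve-∀

    consecutive-0≤· : ∀ {w x} → Consecutive w x → + ∣ yc w ∣ < xc w → 0ℤ ≤ w · x
    consecutive-0≤· {c , d} {r , e} wx ∣d∣<c =
      n∣i⇒0<i+n⇒0≤i 0<P (∈L⇒∣· (c , d) (r , e) ∈L₁ ∈L₂)
        (*-cancelʳ-<-nonNeg c {{nonNegative 0≤x₁}} (subst (0ℤ <_) (sym (identity P c d r e)) 0<rhs))
      where
      open Consecutive wx
      identity : ∀ P c d r e → (c * r + d * e + P) * c
                               ≡ r * (c * c + d * d) + (P * c + d * (c * e - d * r))
      identity = solve-∀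
      0<rhs : 0ℤ < r * (c * c + d * d) + (P * c + d * (c * e - d * r))
      0<rhs = +-mono-≤-< (0≤i⇒0≤j⇒0≤i*j 0≤x₂ (+-mono-≤ (0≤i*i c) (0≤i*i d)))
                         (0<P*c+d*D {d = d} ∣d∣<c det≡±P)

    consecutive-‖‖²≤ : ∀ {w x} → Consecutive w x → 0ℤ ≤ w · x → w · x < ‖ w ‖² →
                       ‖ x ‖² ≤ ‖ w ‖²
    consecutive-‖‖²≤ {w} {x} wx 0≤w·x w·x<‖w‖² =
      M*N≡X*X+P*P⇒N≤M 0<P (∈L⇒∣· w w ∈L₁ ∈L₁) (∈L⇒∣· x x ∈L₂ ∈L₂) (∈L⇒∣· w x ∈L₁ ∈L₂)
        0≤w·x w·x<‖w‖²
        (trans (lagrange-identity w x) (cong (_+_ ((w · x) * (w · x))) (≡±⇒*≡ det≡±P)))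
      where
      open Consecutive wx

    module EuclideanStep {v w} (vw : Consecutive v w) (∣yw∣<xw : + ∣ yc w ∣ < xc w) where

      q : ℤ
      q = ⌊ xc v / xc w ⌋

      x : Vec2
      x = v -[ q ] w

      0<xw : 0ℤ < xc w
      0<xw = ≤-<-trans (+≤+ z≤n) ∣yw∣<xw

      private
        wx : Consecutive w x
        wx = consecutive-euclid-step vw 0<xw

        0≤w·x : 0ℤ ≤ w · x
        0≤w·x = consecutive-0≤· wx ∣yw∣<xw

        w·x<‖w‖² : w · x < ‖ w ‖²
        w·x<‖w‖² = consecutive-·<‖‖² wx (x-⌊x/n⌋*n<n {xc v} 0<xw)

      lagrange-quotient : ⌊ (v · w) / ‖ w ‖² ⌋ ≡ q
      lagrange-quotient = ⌊x/n⌋-unique (0<xv⇒0<‖v‖² {w} 0<xw)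
        (subst (q * ‖ w ‖² ≤_) (sym split) (i≤i+j (q * ‖ w ‖²) (w · x) {{nonNegative 0≤w·x}}))
        (subst (_< q * ‖ w ‖² + ‖ w ‖²) (sym split) (+-monoʳ-< (q * ‖ w ‖²) w·x<‖w‖²))
        where
        split : v · w ≡ q * ‖ w ‖² + w · x
        split = v·w≡q*‖w‖²+w·[v-qw] v w q

      shortens : ‖ x ‖² ≤ ‖ w ‖²
      shortens = consecutive-‖‖²≤ wx 0≤w·x w·x<‖w‖²

module BrillhartLagrange (p u : ℕ) (p∣u*u+1 : + p ∣ℤ + u *ℤ + u +ℤ 1ℤ) (u<p : + u <ℤ + p) where
  open import Data.Nat.Base as ℕ using (suc; zero; z≤n; s≤s)
  import Data.Nat.Properties as ℕ
  open import Data.Integer hiding (suc)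
  open import Data.Integer.Properties
  open import Data.Integer.Divisibility.Signed using (divides)
  open import Data.Integer.Tactic.RingSolver using (solve-∀)
  open import Data.Product using (Σ; _×_; _,_; proj₂)
  open import Data.Sum using (inj₁)
  open import Data.Maybe using (just; nothing)
  import Data.Maybe as Maybe
  open import Data.Maybe.Properties using (just-injective)
  open import Relation.Nullary.Decidable using (dec-true)
  open import Relation.Binary.PropositionalEquality
  open IntegerLemmas
  open PlaneVectors
  open Lattice (+ p) (+ u) p∣u*u+1

  0<p : 0ℤ < + p
  0<p = ≤-<-trans (+≤+ z≤n) u<p

  consecutive-initial : Consecutive (+ p , 0ℤ) (+ u , 1ℤ)
  consecutive-initial = record
    { 0≤x₁ = +≤+ z≤n
    ; 0≤x₂ = +≤+ z≤n
    ; y₁*y₂≤0 = ≤-refl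
    ; det≡±P = inj₁ (det-initial (+ p) (+ u))
    ; ∈L₁ = divides 1ℤ (p∈L (+ p) (+ u))
    ; ∈L₂ = divides 0ℤ (u∈L (+ p) (+ u))
    }
    where
    det-initial : ∀ p u → p * 1ℤ - 0ℤ * u ≡ p
    det-initial = solve-∀
    p∈L : ∀ p u → p - u * 0ℤ ≡ 1ℤ * p
    p∈L = solve-∀
    u∈L : ∀ p u → u - u * 1ℤ ≡ 0ℤ * p
    u∈L = solve-∀

  norm-initial : ‖ (+ u , 1ℤ) ‖² ≤ ‖ (+ p , 0ℤ) ‖²
  norm-initial =
    subst (+ u * + u + 1ℤ ≤_) (sym (+-identityʳ (+ p * + p))) (0≤i⇒i<j⇒i*i+1≤j*j (+≤+ z≤n) u<p)

  brillhartPair-suc : ∀ k {v w} → brillhartPair p u k ≡ just (v , w) → 0ℤ < xc w →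
                      brillhartPair p u (suc k) ≡ just (w , v -[ ⌊ xc v / xc w ⌋ ] w)
  brillhartPair-suc k {w = +[1+ n ] , d} eq _ rewrite eq = refl
  brillhartPair-suc k {w = + 0 , d} _ (+<+ ())

  brillhartPair-suc⁻¹ : ∀ k {w x} → brillhartPair p u (suc k) ≡ just (w , x) →
                        Σ Vec2 λ v → brillhartPair p u k ≡ just (v , w) × 0ℤ < xc w ×
                                     x ≡ v -[ ⌊ xc v / xc w ⌋ ] w
  brillhartPair-suc⁻¹ k eq with brillhartPair p u k | eq
  ... | just (v , (+[1+ n ] , d)) | refl = v , refl , +<+ (s≤s z≤n) , refl
  ... | just (v , (+ zero , d)) | ()
  ... | just (v , (-[1+ n ] , d)) | ()
  ... | nothing | ()

  brillhartPair-consecutive : ∀ k {v w} → brillhartPair p u k ≡ just (v , w) → Consecutive v w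
  brillhartPair-consecutive zero refl = consecutive-initial
  brillhartPair-consecutive (suc k) eq with brillhartPair-suc⁻¹ k eq
  ... | v , eq₀ , 0<xw , refl = consecutive-euclid-step (brillhartPair-consecutive k eq₀) 0<xw

  brillhartPair⇒brillhart : ∀ k {v w} → brillhartPair p u k ≡ just (v , w) → brillhart p u k ≡ just v
  brillhartPair⇒brillhart zero refl = refl
  brillhartPair⇒brillhart (suc k) eq with brillhartPair-suc⁻¹ k eq
  ... | _ , eq₀ , _ = cong (Maybe.map proj₂) eq₀

  brillhart⇒brillhartPair : ∀ k {v w} → brillhart p u k ≡ just v → brillhart p u (suc k) ≡ just w →
                            brillhartPair p u k ≡ just (v , w)
  brillhart⇒brillhartPair k eq₁ eq₂ with brillhartPair p u k in eq | eq₂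
  ... | just (v₀ , w) | refl with trans (sym (brillhartPair⇒brillhart k eq)) eq₁
  ...   | refl = refl

  quotients-agree : (i : ℕ) → (a b c d : ℤ) →
                    brillhart p u i ≡ just (a , b) → brillhart p u (suc i) ≡ just (c , d) → + ∣ d ∣ < c →
                    ⌊ a / c ⌋ ≡ ⌊ (a * c + b * d) / (c * c + d * d) ⌋
  quotients-agree i a b c d eq₁ eq₂ ∣d∣<c = sym (EuclideanStep.lagrange-quotient 0<p
    (brillhartPair-consecutive i (brillhart⇒brillhartPair i eq₁ eq₂)) ∣d∣<c)

  lagrangePair-suc : ∀ k {v w} → lagrangePair p u k ≡ just (v , w) → ‖ w ‖² ≤ ‖ v ‖² →
                     lagrangePair p u (suc k) ≡ just (w , v -[ ⌊ (w · v) / ‖ w ‖² ⌋ ] w)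
  lagrangePair-suc k {v} {w} eq ‖w‖²≤‖v‖²
    rewrite eq | dec-true (‖ w ‖² ≤? ‖ v ‖²) ‖w‖²≤‖v‖² = refl

  record Synchronised (k : ℕ) : Set where
    field
      v w : Vec2
      brillhartPair≡ : brillhartPair p u k ≡ just (v , w)
      lagrangePair≡ : lagrangePair p u k ≡ just (v , w)
      ‖w‖²≤‖v‖² : ‖ w ‖² ≤ ‖ v ‖²

  InCone : ℕ → Set
  InCone k = Σ ℤ λ c → Σ ℤ λ d → brillhart p u k ≡ just (c , d) × + ∣ d ∣ < c

  synchronised-zero : Synchronised zero
  synchronised-zero = record
    { brillhartPair≡ = refl ; lagrangePair≡ = refl ; ‖w‖²≤‖v‖² = norm-initial }

  synchronised-suc : ∀ {k} → Synchronised k → InCone (suc k) → Synchronised (suc k)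
  synchronised-suc {k} s (c , d , eq , ∣d∣<c) = record
    { brillhartPair≡ = brillhartPair-suc k brillhartPair≡ 0<xw
    ; lagrangePair≡ = trans (lagrangePair-suc k lagrangePair≡ ‖w‖²≤‖v‖²)
                        (cong (λ t → just (w , v -[ t ] w)) same-quotient)
    ; ‖w‖²≤‖v‖² = shortens
    }
    where
    open Synchronised s
    w≡c,d : w ≡ (c , d)
    w≡c,d = just-injective (trans (sym (cong (Maybe.map proj₂) brillhartPair≡)) eq)
    cone : + ∣ yc w ∣ < xc w
    cone = subst (λ z → + ∣ yc z ∣ < xc z) (sym w≡c,d) ∣d∣<c
    open EuclideanStep 0<p (brillhartPair-consecutive k brillhartPair≡) cone
    same-quotient : ⌊ (w · v) / ‖ w ‖² ⌋ ≡ q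
    same-quotient = trans (cong (λ t → ⌊ t / ‖ w ‖² ⌋) (·-comm w v)) lagrange-quotient

  synchronised : ∀ k → (∀ j → 1 ℕ.≤ j → j ℕ.≤ k → InCone j) → Synchronised k
  synchronised zero _ = synchronised-zero
  synchronised (suc k) cones =
    synchronised-suc (synchronised k (λ j 1≤j j≤k → cones j 1≤j (ℕ.m≤n⇒m≤1+n j≤k)))
                     (cones (suc k) (s≤s z≤n) ℕ.≤-refl)

  lagrange≡brillhart : ∀ i → (∀ k → 1 ℕ.≤ k → k ℕ.≤ i → InCone k) →
                       ∀ j → j ℕ.≤ suc i → lagrange p u j ≡ brillhart p u j
  lagrange≡brillhart i cones zero _ = refl
  lagrange≡brillhart i cones (suc j) (s≤s j≤i) =
    trans (cong (Maybe.map proj₂) lagrangePair≡) (sym (cong (Maybe.map proj₂) brillhartPair≡))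
    where
    open Synchronised (synchronised j (λ k 1≤k k≤j → cones k 1≤k (ℕ.≤-trans k≤j j≤i)))

open import Data.Nat using (ℕ; suc; _≤_; _<_; _%_; _+_; _*_)
open import Data.Nat.Primality using (Prime)
open import Data.Nat.Divisibility using (_∣_)
open import Data.Integer using (ℤ; ∣_∣) renaming (_<_ to _<ℤ_; _+_ to _+ℤ_; _*_ to _*ℤ_)
open import Data.Product using (_×_; _,_; Σ)
open import Data.Maybe using (just)
open import Relation.Binary.PropositionalEquality using (_≡_)
open import Data.Nat.Properties using (≤-<-trans; m≤n*m)
open import Data.Integer.Base using (+<+)
open IntegerLemmas using (∣n*n+1⇒+∣+n*+n+1)

mainTheorem1 : (p u : ℕ) → Prime p → p % 4 ≡ 1 → p ∣ u * u + 1 → 1 ≤ u → 2 * u < p →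
    -- (1) q_i = q'_i whenever x_i > |y_i|
    ((i : ℕ) → (a b c d : ℤ) →
      brillhart p u i ≡ just (a , b) → brillhart p u (suc i) ≡ just (c , d) →
      Data.Integer.+_ ∣ d ∣ <ℤ c →
      ⌊ a / c ⌋ ≡ ⌊ (a *ℤ c +ℤ b *ℤ d) / (c *ℤ c +ℤ d *ℤ d) ⌋)
    ×
    -- (2) the sequences coincide (and the Lagrange steps are performed)
    --     up to index i+1 as long as x_k > |y_k| for k = 1, …, i
    ((i : ℕ) →
      ((k : ℕ) → 1 ≤ k → k ≤ i →
        Σ ℤ λ c → Σ ℤ λ d → brillhart p u k ≡ just (c , d) × Data.Integer.+_ ∣ d ∣ <ℤ c) →
      (j : ℕ) → j ≤ suc i → lagrange p u j ≡ brillhart p u j)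
mainTheorem1 p u _ _ p∣u*u+1 _ 2u<p = quotients-agree , lagrange≡brillhart
  where
  open BrillhartLagrange p u (∣n*n+1⇒+∣+n*+n+1 {n = u} p∣u*u+1) (+<+ (≤-<-trans (m≤n*m u 2) 2u<p))
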